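{- Let $n\ge3$, $c$ a Coxeter element of $\widehat{\mathfrak S}_n$, $i,j,k\in\{0,\dots,n-1\}$ pairwise distinct and $p,q\in\mathbb N$ with $p\ge\delta_{i>j}$ and $q\ge\delta_{j>k}$. Let $\sigma$ be the permutation of $\{i,j,k\}$ such that $\sigma(i)<\sigma(j)<\sigma(k)$, with sign $\varepsilon(\sigma)$. Then $$\omega_c(\beta_{(i,j)_p},\beta_{(j,k)_q})=\varepsilon(\sigma)(-1)^{\delta_{\sigma(j)\in\overline{R_c}}}-2p\big(\delta_{j\in\overline{R_c}}-\delta_{k\in\overline{R_c}}\big)+2q\big(\delta_{i\in\overline{R_c}}-\delta_{j\in\overline{R_c}}\big).$$
   Context: $\widehat{\mathfrak S}_n$: bijections $w$ of $\mathbb Z$ with $w(k+n)=w(k)+n$, $\sum_{k=1}^nw(k)=\sum_{k=1}^nk$, with simple generators $s_i$ ($0\le i\le n-1$) exchanging $i+mn$ and $i+1+mn$ for all $m$. A Coxeter element $c$ is a product of all $s_i$ once each; $\overline{L_c}=\{x\in\mathbb Z:c(x)>x\}$, $\overline{R_c}=\{x:c(x)<x\}$. For $a\not\equiv b\pmod n$ and $p\in\mathbb Z$, $(a,b)_p$ denotes the affine transposition exchanging $a+mn$ and $b+pn+mn$ for all $m$. $V$ has basis $\alpha_0,\dots,\alpha_{n-1}$, $\delta=\sum_i\alpha_i$; for $0\le a<b\le n$, $\beta_{(a,b)}=\beta_{(b,a)}=\alpha_a+\dots+\alpha_{b-1}$; for $a,b\in\{0,\dots,n-1\}$ distinct and $p\ge\delta_{a>b}$,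 the positive root of $(a,b)_p$ is $\beta_{(a,b)_p}=\beta_{(a,b)}+p\delta$ if $a<b$ and $\beta_{(a,b)_p}=p\delta-\beta_{(b,a)}$ if $a>b$. $\omega_c$ is the skew-symmetric bilinear form on $V$ with $\omega_c(\alpha_a,\alpha_b)=\pm1$ when $b-a\equiv\pm1\pmod n$, sign $+$ iff $s_a$ appears before $s_b$ in a reduced word of $c$, and $0$ otherwise. $\delta_P\in\{0,1\}$ is the indicator of $P$. -}

module Defs where

open import Data.Bool using (Bool; true; false; if_then_else_; _∧_)
open import Data.Nat as ℕ using (ℕ; NonZero; _≡ᵇ_; _<ᵇ_)
open import Data.Nat.DivMod using (_%_)
open import Data.Integer as ℤ using (ℤ; +_; _+_; _-_; _*_; -_; _%ℕ_; _<?_)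
open import Data.Fin using (Fin; toℕ)
open import Data.Fin.Permutation using (Permutation′; _⟨$⟩ʳ_; _⟨$⟩ˡ_)
open import Data.List using (List; foldr; allFin; map)
open import Function using (_∘_; id)
open import Relation.Nullary using (does)

ind : Bool → ℤ
ind true  = + 1
ind false = + 0

sgn : Bool → ℤ
sgn true  = - (+ 1)
sgn false = + 1

xor : Bool → Bool → Bool
xor true b = if b then false else true
xor false b = b

sumℤ : List ℤ → ℤ
sumℤ = foldr _+_ (+ 0)

Σ[_] : (n : ℕ) → (Fin n → ℤ) → ℤ
Σ[ n ] f = sumℤ (map f (allFin n))

module _ (n : ℕ) .{{nz : NonZero n}} where

  -- simple generator s_i of the affine symmetric group, acting on ℤ:
  -- exchanges i + mn and i + 1 + mn for all m
  s : Fin n → ℤ → ℤ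
  s i x =
    if (x %ℕ n) ≡ᵇ toℕ i then x + + 1
    else if (x %ℕ n) ≡ᵇ ((ℕ.suc (toℕ i)) % n) then x - + 1
    else x

  -- A Coxeter element is given by a word s_{w(0)} s_{w(1)} ⋯ s_{w(n-1)}
  -- in which every generator appears exactly once; w : position ↦ generator.
  coxFun : Permutation′ n → ℤ → ℤ
  coxFun w = foldr (λ t f → s (w ⟨$⟩ʳ t) ∘ f) id (allFin n)

  inR : Permutation′ n → ℤ → Bool
  inR w x = does (coxFun w x <? x)

  before : Permutation′ n → Fin n → Fin n → Bool
  before w a b = toℕ (w ⟨$⟩ˡ a) <ᵇ toℕ (w ⟨$⟩ˡ b)

  -- Vectors in V, coordinates in the basis α_0, …, α_{n-1}
  V : Set
  V = Fin n → ℤ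

  ωbasis : Permutation′ n → Fin n → Fin n → ℤ
  ωbasis w a b =
    if ((ℕ.suc (toℕ a)) % n ≡ᵇ toℕ b) then (if before w a b then + 1 else - (+ 1))
    else if ((ℕ.suc (toℕ b)) % n ≡ᵇ toℕ a) then (if before w a b then + 1 else - (+ 1))
    else + 0

  ω : Permutation′ n → V → V → ℤ
  ω w u v = Σ[ n ] (λ a → Σ[ n ] (λ b → u a * v b * ωbasis w a b))

  δV : V
  δV _ = + 1

  -- β_{(a,b)} = α_a + ⋯ + α_{b-1} for a < b (coefficient of α_m is [a ≤ m < b])
  βint : ℕ → ℕ → V
  βint a b m = ind ((a ℕ.≤ᵇ toℕ m) ∧ (toℕ m <ᵇ b))

  -- positive root of (a,b)_p for a ≠ b in {0,…,n-1}, p ≥ δ_{a>b}: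
  -- β_{(a,b)} + pδ if a < b, and pδ − β_{(b,a)} if a > b
  βroot : Fin n → Fin n → ℕ → V
  βroot a b p m =
    if toℕ a <ᵇ toℕ b then βint (toℕ a) (toℕ b) m + + p * δV m
    else + p * δV m - βint (toℕ b) (toℕ a) m

-- σ : the permutation of {i,j,k} with σ(i) < σ(j) < σ(k); returns σ(x) for x ∈ {i,j,k}
-- (x = i ↦ min, x = j ↦ median, x = k ↦ max)
min3 max3 med3 : ℕ → ℕ → ℕ → ℕ
min3 i j k = ℕ._⊓_ i (ℕ._⊓_ j k)
max3 i j k = ℕ._⊔_ i (ℕ._⊔_ j k)
med3 i j k = ℕ._⊔_ (ℕ._⊓_ i j) (ℕ._⊓_ (ℕ._⊔_ i j) k)

σ : ℕ → ℕ → ℕ → ℕ → ℕ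
σ i j k x =
  if x ≡ᵇ i then min3 i j k
  else if x ≡ᵇ j then med3 i j k
  else max3 i j k

inv : ℕ → ℕ → ℕ → ℕ → ℕ → Bool
inv i j k x y = (x <ᵇ y) ∧ (σ i j k y <ᵇ σ i j k x)

-- sign ε(σ) = (-1)^{number of inversions of σ}, inversions counted over the
-- (unordered) pairs of {i,j,k}, each pair tested in both orders
signσ : ℕ → ℕ → ℕ → ℤ
signσ i j k =
  sgn (xor (xor (inv i j k i j) (inv i j k j i))
       (xor (xor (inv i j k i k) (inv i j k k i))
            (xor (inv i j k j k) (inv i j k k j))))

module Submission where

-- In the basis α₀, …, αₙ₋₁ the form ω_c only pairs neighbours on the n-cycle, and
-- ω_c(α_{r-1}, α_r) = (-1)^{δ_{r ∈ R̄_c}}: the integer r is moved only by s_r (up) and by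
-- s_{r-1} (down), and since every generator occurs once in c, whichever of the two acts first
-- decides on which side of r the point c(r) lands.  Summing by parts around the cycle, and
-- using that the discrete derivative of β_{(a,b)_p} is the indicator of a minus that of b,
-- ω_c(β_{(i,j)_p}, β_{(j,k)_q}) reduces to four point evaluations.  The parts linear in p and q
-- give the last two terms of the formula; what is left depends only on the relative order of
-- i, j, k, and is checked on the six orderings of 0, 1, 2.

open import Defs
open import Data.Nat using (ℕ; NonZero; _≤_; _<_)
open import Data.Integer using (ℤ; +_; _+_; _-_; _*_)
open import Data.Fin using (Fin; toℕ)
open import Data.Fin.Permutation using (Permutation′)
open import Relation.Binary.PropositionalEquality using (_≡_; _≢_)

open import Data.Bool using (true; false; not; _∧_; if_then_else_)
open import Data.Bool.Properties using (∧-zeroʳ)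
open import Data.Fin as Fin using (fromℕ; inject₁)
import Data.Fin.Properties as Fin
open import Data.Fin.Permutation using (_⟨$⟩ʳ_; _⟨$⟩ˡ_; inverseˡ; inverseʳ; flip)
open import Data.Integer as ℤ using (-[1+_]; -_; _%ℕ_; _<?_)
import Data.Integer.Properties as ℤ
open import Algebra.Properties.Semiring.Sum ℤ.+-*-semiring
  using (sum; ∑-distrib-+; ∑-comm; sum-cong-≗; sum-remove; sum-replicate-zero; *-distribˡ-sum)
open import Data.Integer.DivMod using (n%ℕd<d)
open import Data.Integer.Tactic.RingSolver using (solve-∀)
open import Data.List using (foldr; map; tabulate)
open import Data.Nat as ℕ using (zero; suc; z≤n; s≤s; _⊓_; _⊔_; _≡ᵇ_; _<ᵇ_; _≤ᵇ_; _∸_; _%_)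
import Data.Nat.Properties as ℕ
open import Data.Nat.DivMod using (%-distribˡ-+; m%n%n≡m%n; m<n⇒m%n≡m; n%n≡0; m%n<n)
open import Data.Product using (_×_; _,_; proj₁; ∃-syntax)
open import Data.Sum using (_⊎_; inj₁; inj₂)
open import Function using (_∘_; _$_; id)
open import Function.Bundles using (Injection)
open import Function.Definitions using (Injective)
open import Function.Properties.Inverse using (↔⇒↣)
open import Relation.Binary.Core using (_Preserves_⟶_)
open import Relation.Binary.Definitions using (tri<; tri≈; tri>)
open import Relation.Binary.PropositionalEquality using (refl; sym; trans; cong; cong₂; subst; module ≡-Reasoning)
open import Relation.Nullary using (¬_; does; yes; no)
open import Relation.Nullary.Decidable using (dec-true; dec-false)
open import Relation.Nullary.Negation using (contradiction)
open import Relation.Nullary.Reflects using (Reflects; ofʸ; ofⁿ; fromEquivalence; det)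

≡ᵇ-reflects : ∀ m n → Reflects (m ≡ n) (m ≡ᵇ n)
≡ᵇ-reflects m n = fromEquivalence (ℕ.≡ᵇ⇒≡ m n) (ℕ.≡⇒≡ᵇ m n)

Σ≡sum : ∀ K (f : Fin K → ℤ) → Σ[ K ] f ≡ sum f
Σ≡sum K f = sum-tabulate id
  where
  sum-tabulate : ∀ {M} (e : Fin M → Fin K) → sumℤ (map f (tabulate e)) ≡ sum (f ∘ e)
  sum-tabulate {zero}  e = refl
  sum-tabulate {suc M} e = cong (_+_ (f (e Fin.zero))) (sum-tabulate (e ∘ Fin.suc))

sum-supported : ∀ {K} (f : Fin (suc K) → ℤ) t → (∀ r → r ≢ t → f r ≡ + 0) → sum f ≡ f t
sum-supported {K} f t vanishes = begin
  sum f                          ≡⟨ sum-remove {i = t} f ⟩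
  f t + sum (f ∘ Fin.punchIn t)  ≡⟨ cong (_+_ (f t)) (sum-cong-≗ (λ r → vanishes _ (Fin.punchInᵢ≢i t r))) ⟩
  f t + sum {K} (λ _ → + 0)      ≡⟨ cong (_+_ (f t)) (sum-replicate-zero K) ⟩
  f t + + 0                      ≡⟨ ℤ.+-identityʳ (f t) ⟩
  f t                            ∎
  where open ≡-Reasoning

∑-distrib-- : ∀ {K} (f g : Fin K → ℤ) → sum (λ r → f r - g r) ≡ sum f - sum g
∑-distrib-- f g = trans (∑-distrib-+ f (-_ ∘ g)) (cong (_+_ (sum f)) ∑-neg)
  where
  open ≡-Reasoning
  ∑-neg : sum (-_ ∘ g) ≡ - sum g
  ∑-neg = begin
    sum (-_ ∘ g)             ≡⟨ sum-cong-≗ (λ r → ℤ.-1*i≡-i (g r)) ⟨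
    sum (λ r → - + 1 * g r)  ≡⟨ *-distribˡ-sum (- + 1) g ⟨
    - + 1 * sum g            ≡⟨ ℤ.-1*i≡-i (sum g) ⟩
    - sum g                  ∎

interval : ℕ → ℕ → ℕ → ℤ
interval lo hi x = ind ((lo ≤ᵇ x) ∧ (x <ᵇ hi))

segment : ℕ → ℕ → ℕ → ℤ
segment a b x = interval a b x - interval b a x

interval-empty : ∀ {lo hi} → hi ≤ lo → ∀ x → interval lo hi x ≡ + 0
interval-empty {lo} {hi} hi≤lo x with lo ≤ᵇ x | ℕ.≤ᵇ-reflects-≤ lo x | x <ᵇ hi | ℕ.<ᵇ-reflects-< x hi
... | false | _        | _     | _        = refl
... | true  | _        | false | _        = refl
... | true  | ofʸ lo≤x | true  | ofʸ x<hi = contradiction (ℕ.≤-trans hi≤lo lo≤x) (ℕ.<⇒≱ x<hi)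

interval-beyond : ∀ {lo hi x} → hi ≤ x → interval lo hi x ≡ + 0
interval-beyond {lo} {hi} {x} hi≤x rewrite det (ℕ.<ᵇ-reflects-< x hi) (ofⁿ (ℕ.≤⇒≯ hi≤x)) =
  cong ind (∧-zeroʳ (lo ≤ᵇ x))

interval-zero : ∀ {lo hi} → lo ≤ hi → interval lo hi 0 ≡ ind (lo ≡ᵇ 0) - ind (hi ≡ᵇ 0)
interval-zero {zero}  {zero}  _ = refl
interval-zero {zero}  {suc _} _ = refl
interval-zero {suc _} {suc _} _ = refl

interval-shift : ∀ lo hi x → interval (suc lo) (suc hi) (suc x) ≡ interval lo hi x
interval-shift zero    _ _ = refl
interval-shift (suc _) _ _ = refl

interval-suc : ∀ {lo hi} → lo ≤ hi → ∀ x →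
               interval lo hi (suc x) - interval lo hi x ≡ ind (lo ≡ᵇ suc x) - ind (hi ≡ᵇ suc x)
interval-suc {zero}  {zero}  _ x = refl
interval-suc {zero}  {suc h} _ x = below-suc x h
  where
  below-suc : ∀ x h → ind (x <ᵇ h) - ind (x <ᵇ suc h) ≡ + 0 - ind (h ≡ᵇ x)
  below-suc zero    zero    = refl
  below-suc zero    (suc h) = refl
  below-suc (suc x) zero    = refl
  below-suc (suc x) (suc h) = below-suc x h
interval-suc {suc l} {suc h} (s≤s l≤h) zero =
  trans (cong (_- + 0) (interval-shift l h 0)) (trans (ℤ.+-identityʳ _) (interval-zero l≤h))
interval-suc {suc l} {suc h} (s≤s l≤h) (suc x) =
  trans (cong₂ _-_ (interval-shift l h (suc x)) (interval-shift l h x)) (interval-suc l≤h x)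

-- With Y x = (-1)^{δ_{x ∈ R̄_c}}, the left-hand side is ω_c(β_{(i,j)_0}, β_{(j,k)_0}).
MedianIdentity : (ℕ → ℤ) → ℕ → ℕ → ℕ → Set
MedianIdentity Y i j k =
  Y j * segment i j j - Y k * segment i j k - (Y i * segment j k i - Y j * segment j k j)
    ≡ signσ i j k * Y (σ i j k j)

module OrderInvariance {f : ℕ → ℕ} (f-mono : f Preserves _<_ ⟶ _<_) where

  private
    f-≤ : f Preserves _≤_ ⟶ _≤_
    f-≤ m≤n with ℕ.m≤n⇒m<n∨m≡n m≤n
    ... | inj₁ m<n  = ℕ.<⇒≤ (f-mono m<n)
    ... | inj₂ refl = ℕ.≤-refl

    f-reflects-< : ∀ {m n} → f m < f n → m < n
    f-reflects-< fm<fn = ℕ.≰⇒> (λ n≤m → ℕ.<⇒≱ fm<fn (f-≤ n≤m))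

    f-reflects-≤ : ∀ {m n} → f m ≤ f n → m ≤ n
    f-reflects-≤ fm≤fn = ℕ.≮⇒≥ (λ n<m → ℕ.<⇒≱ (f-mono n<m) fm≤fn)

    f-injective : ∀ {m n} → f m ≡ f n → m ≡ n
    f-injective fm≡fn =
      ℕ.≤-antisym (f-reflects-≤ (ℕ.≤-reflexive fm≡fn)) (f-reflects-≤ (ℕ.≤-reflexive (sym fm≡fn)))

  <ᵇ-relabel : ∀ m n → (f m <ᵇ f n) ≡ (m <ᵇ n)
  <ᵇ-relabel m n =
    det (fromEquivalence (f-reflects-< ∘ ℕ.<ᵇ⇒< _ _) (ℕ.<⇒<ᵇ ∘ f-mono)) (ℕ.<ᵇ-reflects-< m n)

  ≤ᵇ-relabel : ∀ m n → (f m ≤ᵇ f n) ≡ (m ≤ᵇ n)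
  ≤ᵇ-relabel m n =
    det (fromEquivalence (f-reflects-≤ ∘ ℕ.≤ᵇ⇒≤ _ _) (ℕ.≤⇒≤ᵇ ∘ f-≤)) (ℕ.≤ᵇ-reflects-≤ m n)

  ≡ᵇ-relabel : ∀ m n → (f m ≡ᵇ f n) ≡ (m ≡ᵇ n)
  ≡ᵇ-relabel m n =
    det (fromEquivalence (f-injective ∘ ℕ.≡ᵇ⇒≡ _ _) (ℕ.≡⇒≡ᵇ _ _ ∘ cong f)) (≡ᵇ-reflects m n)

  ⊓-relabel : ∀ m n → f m ⊓ f n ≡ f (m ⊓ n)
  ⊓-relabel m n = sym (ℕ.mono-≤-distrib-⊓ f-≤ m n)

  ⊔-relabel : ∀ m n → f m ⊔ f n ≡ f (m ⊔ n)
  ⊔-relabel m n = sym (ℕ.mono-≤-distrib-⊔ f-≤ m n)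

  min3-relabel : ∀ i j k → min3 (f i) (f j) (f k) ≡ f (min3 i j k)
  min3-relabel i j k = trans (cong (f i ⊓_) (⊓-relabel j k)) (⊓-relabel i (j ⊓ k))

  max3-relabel : ∀ i j k → max3 (f i) (f j) (f k) ≡ f (max3 i j k)
  max3-relabel i j k = trans (cong (f i ⊔_) (⊔-relabel j k)) (⊔-relabel i (j ⊔ k))

  med3-relabel : ∀ i j k → med3 (f i) (f j) (f k) ≡ f (med3 i j k)
  med3-relabel i j k =
    trans (cong₂ _⊔_ (⊓-relabel i j) (trans (cong (_⊓ f k) (⊔-relabel i j)) (⊓-relabel (i ⊔ j) k)))
          (⊔-relabel (i ⊓ j) ((i ⊔ j) ⊓ k))

  σ-relabel : ∀ i j k x → σ (f i) (f j) (f k) (f x) ≡ f (σ i j k x)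
  σ-relabel i j k x
    rewrite ≡ᵇ-relabel x i | ≡ᵇ-relabel x j | min3-relabel i j k | med3-relabel i j k | max3-relabel i j k
    with x ≡ᵇ i | x ≡ᵇ j
  ... | true  | _     = refl
  ... | false | true  = refl
  ... | false | false = refl

  inv-relabel : ∀ i j k x y → inv (f i) (f j) (f k) (f x) (f y) ≡ inv i j k x y
  inv-relabel i j k x y
    rewrite σ-relabel i j k x | σ-relabel i j k y | <ᵇ-relabel x y | <ᵇ-relabel (σ i j k y) (σ i j k x)
    = refl

  signσ-relabel : ∀ i j k → signσ (f i) (f j) (f k) ≡ signσ i j k
  signσ-relabel i j k = cong sgn (cong₂ xor (cong₂ xor (r i j) (r j i))
                                            (cong₂ xor (cong₂ xor (r i k) (r k i)) (cong₂ xor (r j k) (r k j))))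
    where r = inv-relabel i j k

  segment-relabel : ∀ a b x → segment (f a) (f b) (f x) ≡ segment a b x
  segment-relabel a b x
    rewrite ≤ᵇ-relabel a x | ≤ᵇ-relabel b x | <ᵇ-relabel x a | <ᵇ-relabel x b = refl

  relabel : ∀ i j k → (∀ Y → MedianIdentity Y i j k) → ∀ Y → MedianIdentity Y (f i) (f j) (f k)
  relabel i j k identity Y
    rewrite segment-relabel i j j | segment-relabel i j k | segment-relabel j k i | segment-relabel j k j
          | signσ-relabel i j k | σ-relabel i j k j = identity (Y ∘ f)

open OrderInvariance using (relabel)

spread : ℕ → ℕ → ℕ → ℕ → ℕ
spread a b c 0             = a
spread a b c 1             = b
spread a b c (suc (suc m)) = m ℕ.+ c

spread-mono : ∀ {a b c} → a < b → b < c → spread a b c Preserves _<_ ⟶ _<_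
spread-mono a<b b<c {0}           {1}           _               = a<b
spread-mono a<b b<c {0}           {suc (suc n)} _               = ℕ.<-≤-trans (ℕ.<-trans a<b b<c) (ℕ.m≤n+m _ n)
spread-mono a<b b<c {1}           {suc (suc n)} _               = ℕ.<-≤-trans b<c (ℕ.m≤n+m _ n)
spread-mono a<b b<c {suc (suc m)} {suc (suc n)} (s≤s (s≤s m<n)) = ℕ.+-monoˡ-< _ m<n
spread-mono _   _   {1}           {1}           (s≤s ())
spread-mono _   _   {suc (suc m)} {1}           (s≤s ())

-- Each ordering of i, j, k is the image under a strictly monotone spread of a permutation of
-- 0, 1, 2, where the identity becomes a ring identity in Y 0, Y 1, Y 2.
median-identity : ∀ Y {i j k} → i ≢ j → j ≢ k → i ≢ k → MedianIdentity Y i j k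
median-identity Y {i} {j} {k} i≢j j≢k i≢k with ℕ.<-cmp i j | ℕ.<-cmp j k | ℕ.<-cmp i k
... | tri≈ _ i≡j _ | _            | _            = contradiction i≡j i≢j
... | _            | tri≈ _ j≡k _ | _            = contradiction j≡k j≢k
... | _            | _            | tri≈ _ i≡k _ = contradiction i≡k i≢k
... | tri< i<j _ _ | tri< j<k _ _ | _            =
  relabel (spread-mono i<j j<k) 0 1 2 (λ Y → ring (Y 0) (Y 1) (Y 2)) Y
  where ring : ∀ a b c → b * + 0 - c * + 0 - (a * + 0 - b * + 1) ≡ + 1 * b
        ring = solve-∀
... | tri< i<j _ _ | tri> _ _ k<j | tri< i<k _ _ =
  relabel (spread-mono i<k k<j) 0 2 1 (λ Y → ring (Y 0) (Y 1) (Y 2)) Y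
  where ring : ∀ a b c → c * + 0 - b * + 1 - (a * + 0 - c * + 0) ≡ - + 1 * b
        ring = solve-∀
... | tri> _ _ j<i | tri< j<k _ _ | tri< i<k _ _ =
  relabel (spread-mono j<i i<k) 1 0 2 (λ Y → ring (Y 0) (Y 1) (Y 2)) Y
  where ring : ∀ a b c → a * - + 1 - c * + 0 - (b * + 1 - a * + 1) ≡ - + 1 * b
        ring = solve-∀
... | tri> _ _ j<i | tri< j<k _ _ | tri> _ _ k<i =
  relabel (spread-mono j<k k<i) 2 0 1 (λ Y → ring (Y 0) (Y 1) (Y 2)) Y
  where ring : ∀ a b c → a * - + 1 - b * - + 1 - (c * + 0 - a * + 1) ≡ + 1 * b
        ring = solve-∀
... | tri< i<j _ _ | tri> _ _ k<j | tri> _ _ k<i =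
  relabel (spread-mono k<i i<j) 1 2 0 (λ Y → ring (Y 0) (Y 1) (Y 2)) Y
  where ring : ∀ a b c → c * + 0 - a * + 0 - (b * - + 1 - c * + 0) ≡ + 1 * b
        ring = solve-∀
... | tri> _ _ j<i | tri> _ _ k<j | _            =
  relabel (spread-mono k<j j<i) 2 1 0 (λ Y → ring (Y 0) (Y 1) (Y 2)) Y
  where ring : ∀ a b c → b * - + 1 - a * + 0 - (c * + 0 - b * + 0) ≡ - + 1 * b
        ring = solve-∀

module Cycle (N : ℕ) where

  n : ℕ
  n = suc N

  sucMod : ℕ → ℕ
  sucMod a = suc a % n

  pre : Fin n → Fin n
  pre Fin.zero    = fromℕ N
  pre (Fin.suc i) = inject₁ i

  below-N : (a : Fin n) → toℕ a ≤ N
  below-N a = ℕ.s≤s⁻¹ (Fin.toℕ<n a)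

  sucMod-pre : ∀ r → sucMod (toℕ (pre r)) ≡ toℕ r
  sucMod-pre Fin.zero    = trans (cong sucMod (Fin.toℕ-fromℕ N)) (n%n≡0 n)
  sucMod-pre (Fin.suc i) =
    trans (cong sucMod (Fin.toℕ-inject₁ i)) (m<n⇒m%n≡m (Fin.toℕ<n (Fin.suc i)))

  sucMod-cases : ∀ {a} → a < n → (suc a < n × sucMod a ≡ suc a) ⊎ (suc a ≡ n × sucMod a ≡ 0)
  sucMod-cases a<n with ℕ.m≤n⇒m<n∨m≡n a<n
  ... | inj₁ 1+a<n = inj₁ (1+a<n , m<n⇒m%n≡m 1+a<n)
  ... | inj₂ 1+a≡n = inj₂ (1+a≡n , trans (cong (_% n) 1+a≡n) (n%n≡0 n))

  sucMod-injective : ∀ {a b} → a < n → b < n → sucMod a ≡ sucMod b → a ≡ b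
  sucMod-injective a<n b<n eq with sucMod-cases a<n | sucMod-cases b<n
  ... | inj₁ (_ , ea) | inj₁ (_ , eb) = ℕ.suc-injective (trans (sym ea) (trans eq eb))
  ... | inj₂ (ea , _) | inj₂ (eb , _) = ℕ.suc-injective (trans ea (sym eb))
  ... | inj₁ (_ , ea) | inj₂ (_ , eb) = contradiction (trans (sym ea) (trans eq eb)) λ ()
  ... | inj₂ (_ , ea) | inj₁ (_ , eb) = contradiction (trans (sym eb) (trans (sym eq) ea)) λ ()

  sucMod≡⇒pre : ∀ {a b} → sucMod (toℕ a) ≡ toℕ b → a ≡ pre b
  sucMod≡⇒pre {a} {b} eq = Fin.toℕ-injective
    (sucMod-injective (Fin.toℕ<n a) (Fin.toℕ<n (pre b)) (trans eq (sym (sucMod-pre b))))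

  sucMod-irreflexive : 1 ≤ N → ∀ {a} → a < n → sucMod a ≢ a
  sucMod-irreflexive 1≤N a<n eq with sucMod-cases a<n
  ... | inj₁ (_ , e) = ℕ.1+n≢n (trans (sym e) eq)
  ... | inj₂ (1+a≡n , e) with trans (sym eq) e
  ...   | refl = ℕ.<-irrefl (ℕ.suc-injective 1+a≡n) 1≤N

  sucMod²-irreflexive : 2 ≤ N → ∀ {a} → a < n → sucMod (sucMod a) ≢ a
  sucMod²-irreflexive 2≤N {a} a<n eq with sucMod-cases a<n
  ... | inj₂ (1+a≡n , e) = ℕ.<-irrefl (ℕ.suc-injective 1+a≡n) (subst (λ x → suc x ≤ N) 1≡a 2≤N)
    where 1≡a : 1 ≡ a
          1≡a = trans (sym (m<n⇒m%n≡m (s≤s (ℕ.<⇒≤ 2≤N)))) (trans (cong sucMod (sym e)) eq)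
  ... | inj₁ (1+a<n , e) with sucMod-cases 1+a<n
  ...   | inj₁ (_ , e′) = ℕ.<-irrefl (trans (sym eq) (trans (cong sucMod e) e′)) (ℕ.n≤1+n (suc a))
  ...   | inj₂ (2+a≡n , e′) with trans (sym eq) (trans (cong sucMod e) e′)
  ...     | refl = ℕ.<-irrefl (ℕ.suc-injective 2+a≡n) 2≤N

  pre-irreflexive : 1 ≤ N → ∀ r → pre r ≢ r
  pre-irreflexive 1≤N r eq =
    sucMod-irreflexive 1≤N (Fin.toℕ<n r) (subst (λ x → sucMod (toℕ x) ≡ toℕ r) eq (sucMod-pre r))

  pre²-irreflexive : 2 ≤ N → ∀ r → pre (pre r) ≢ r
  pre²-irreflexive 2≤N r eq = sucMod²-irreflexive 2≤N (Fin.toℕ<n r)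
    (subst (λ x → sucMod (sucMod (toℕ x)) ≡ toℕ r) eq
           (trans (cong sucMod (sucMod-pre (pre r))) (sucMod-pre r)))

  %-suc : ∀ m → suc m % n ≡ sucMod (m % n)
  %-suc m = begin
    (1 ℕ.+ m) % n              ≡⟨ %-distribˡ-+ 1 m n ⟩
    (1 % n ℕ.+ m % n) % n      ≡⟨ cong (λ x → (1 % n ℕ.+ x) % n) (m%n%n≡m%n m n) ⟨
    (1 % n ℕ.+ m % n % n) % n  ≡⟨ %-distribˡ-+ 1 (m % n) n ⟨
    (1 ℕ.+ m % n) % n          ∎
    where open ≡-Reasoning

  private
    negMod : ℕ → ℕ
    negMod zero    = zero
    negMod (suc r) = n ∸ suc r

    -[1+]%ℕ : ∀ m → -[1+ m ] %ℕ n ≡ negMod (suc m % n)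
    -[1+]%ℕ m with suc m % n
    ... | zero  = refl
    ... | suc _ = refl

    -[1+]+1%ℕ : ∀ m → (-[1+ m ] + + 1) %ℕ n ≡ negMod (m % n)
    -[1+]+1%ℕ zero    = refl
    -[1+]+1%ℕ (suc m) = -[1+]%ℕ m

    sucMod-negMod : ∀ {r} → r < n → sucMod (negMod (sucMod r)) ≡ negMod r
    sucMod-negMod {r} r<n with sucMod-cases r<n
    ... | inj₁ (1+r<n , e) rewrite e =
      trans (cong (_% n) (sym (ℕ.+-∸-assoc 1 (ℕ.<⇒≤ 1+r<n)))) (n∸r%n r)
      where
      n∸r%n : ∀ r → (n ∸ r) % n ≡ negMod r
      n∸r%n zero    = n%n≡0 n
      n∸r%n (suc r) = m<n⇒m%n≡m (s≤s (ℕ.m∸n≤m N r))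
    ... | inj₂ (1+r≡n , e) rewrite e = 1%n≡negMod r 1+r≡n
      where
      1%n≡negMod : ∀ r → suc r ≡ n → 1 % n ≡ negMod r
      1%n≡negMod zero    1≡n   = subst (λ x → x % n ≡ 0) (sym 1≡n) (n%n≡0 n)
      1%n≡negMod (suc r) 2+r≡n = trans (m<n⇒m%n≡m (subst (2 ≤_) 2+r≡n (s≤s (s≤s z≤n))))
                                       (sym (subst (λ x → x ∸ suc r ≡ 1) 2+r≡n (ℕ.m+n∸n≡m 1 (suc r))))

  %ℕ-suc : ∀ z → (z + + 1) %ℕ n ≡ sucMod (z %ℕ n)
  %ℕ-suc (+ m)    = trans (cong (_% n) (ℕ.+-comm m 1)) (%-suc m)
  %ℕ-suc -[1+ m ] = begin
    (-[1+ m ] + + 1) %ℕ n             ≡⟨ -[1+]+1%ℕ m ⟩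
    negMod (m % n)                    ≡⟨ sucMod-negMod (m%n<n m n) ⟨
    sucMod (negMod (sucMod (m % n)))  ≡⟨ cong (sucMod ∘ negMod) (%-suc m) ⟨
    sucMod (negMod (suc m % n))       ≡⟨ cong sucMod (-[1+]%ℕ m) ⟨
    sucMod (-[1+ m ] %ℕ n)            ∎
    where open ≡-Reasoning

  -- Summation by parts around the cycle

  δ : Fin n → Fin n → ℤ
  δ a r = ind (toℕ a ≡ᵇ toℕ r)

  ∑-δ : ∀ (f : Fin n → ℤ) a → sum (λ r → f r * δ a r) ≡ f a
  ∑-δ f a = trans (sum-supported _ a off-a) at-a
    where
    off-a : ∀ r → r ≢ a → f r * δ a r ≡ + 0
    off-a r r≢a rewrite det (≡ᵇ-reflects (toℕ a) (toℕ r)) (ofⁿ (r≢a ∘ sym ∘ Fin.toℕ-injective)) =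
      ℤ.*-zeroʳ (f r)
    at-a : f a * δ a a ≡ f a
    at-a rewrite det (≡ᵇ-reflects (toℕ a) (toℕ a)) (ofʸ refl) = ℤ.*-identityʳ (f a)

  ∑-δ-δ : ∀ (f : Fin n → ℤ) a b → sum (λ r → f r * (δ a r - δ b r)) ≡ f a - f b
  ∑-δ-δ f a b = begin
    sum (λ r → f r * (δ a r - δ b r))
      ≡⟨ sum-cong-≗ (λ r → distrib (f r) (δ a r) (δ b r)) ⟩
    sum (λ r → f r * δ a r - f r * δ b r)
      ≡⟨ ∑-distrib-- (λ r → f r * δ a r) (λ r → f r * δ b r) ⟩
    sum (λ r → f r * δ a r) - sum (λ r → f r * δ b r)
      ≡⟨ cong₂ _-_ (∑-δ f a) (∑-δ f b) ⟩
    f a - f b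
      ∎
    where
    open ≡-Reasoning
    distrib : ∀ x y z → x * (y - z) ≡ x * y - x * z
    distrib = solve-∀

  ∑-by-parts : ∀ (Y u v : Fin n → ℤ) {a b c d} →
    (∀ r → u r - u (pre r) ≡ δ a r - δ b r) → (∀ r → v r - v (pre r) ≡ δ c r - δ d r) →
    sum (λ r → Y r * (u (pre r) * v r - u r * v (pre r)))
      ≡ Y c * u c - Y d * u d - (Y a * v a - Y b * v b)
  ∑-by-parts Y u v {a} {b} {c} {d} ∂u ∂v = begin
    sum (λ r → Y r * (u (pre r) * v r - u r * v (pre r)))
      ≡⟨ sum-cong-≗ (λ r → trans (by-parts (Y r) (u r) (u (pre r)) (v r) (v (pre r)))
                                  (cong₂ (λ x y → Y r * u r * x - Y r * v r * y) (∂v r) (∂u r))) ⟩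
    sum (λ r → Y r * u r * (δ c r - δ d r) - Y r * v r * (δ a r - δ b r))
      ≡⟨ ∑-distrib-- (λ r → Y r * u r * (δ c r - δ d r)) (λ r → Y r * v r * (δ a r - δ b r)) ⟩
    sum (λ r → Y r * u r * (δ c r - δ d r)) - sum (λ r → Y r * v r * (δ a r - δ b r))
      ≡⟨ cong₂ _-_ (∑-δ-δ (λ r → Y r * u r) c d) (∑-δ-δ (λ r → Y r * v r) a b) ⟩
    Y c * u c - Y d * u d - (Y a * v a - Y b * v b)
      ∎
    where
    open ≡-Reasoning
    by-parts : ∀ y x x′ z z′ → y * (x′ * z - x * z′) ≡ y * x * (z - z′) - y * z * (x - x′)
    by-parts = solve-∀

  interval-∂ : ∀ {lo hi} → lo ≤ hi → hi ≤ N → ∀ r →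
               interval lo hi (toℕ r) - interval lo hi (toℕ (pre r))
                 ≡ ind (lo ≡ᵇ toℕ r) - ind (hi ≡ᵇ toℕ r)
  interval-∂ {lo} lo≤hi hi≤N Fin.zero rewrite Fin.toℕ-fromℕ N | interval-beyond {lo} hi≤N =
    trans (ℤ.+-identityʳ _) (interval-zero lo≤hi)
  interval-∂ lo≤hi hi≤N (Fin.suc i) rewrite Fin.toℕ-inject₁ i = interval-suc lo≤hi (toℕ i)

  segment-∂ : ∀ a b r →
              segment (toℕ a) (toℕ b) (toℕ r) - segment (toℕ a) (toℕ b) (toℕ (pre r)) ≡ δ a r - δ b r
  segment-∂ a b r with ℕ.≤-total (toℕ a) (toℕ b)
  ... | inj₁ a≤b rewrite interval-empty a≤b (toℕ r) | interval-empty a≤b (toℕ (pre r)) =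
    trans (drop-zeros (interval (toℕ a) (toℕ b) (toℕ r)) (interval (toℕ a) (toℕ b) (toℕ (pre r))))
          (interval-∂ a≤b (below-N b) r)
    where drop-zeros : ∀ x y → x - + 0 - (y - + 0) ≡ x - y
          drop-zeros = solve-∀
  ... | inj₂ b≤a rewrite interval-empty b≤a (toℕ r) | interval-empty b≤a (toℕ (pre r)) =
    trans (negate (interval (toℕ b) (toℕ a) (toℕ r)) (interval (toℕ b) (toℕ a) (toℕ (pre r))))
          (trans (cong -_ (interval-∂ b≤a (below-N a) r)) (neg-difference (δ b r) (δ a r)))
    where negate : ∀ x y → + 0 - x - (+ 0 - y) ≡ - (x - y)
          negate = solve-∀
          neg-difference : ∀ x y → - (x - y) ≡ y - x
          neg-difference = solve-∀

  βroot-segment : ∀ a b p m → βroot n a b p m ≡ + p + segment (toℕ a) (toℕ b) (toℕ m)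
  βroot-segment a b p m with toℕ a <ᵇ toℕ b | ℕ.<ᵇ-reflects-< (toℕ a) (toℕ b)
  ... | true  | ofʸ a<b rewrite interval-empty (ℕ.<⇒≤ a<b) (toℕ m) =
    ascending (interval (toℕ a) (toℕ b) (toℕ m)) (+ p)
    where ascending : ∀ x P → x + P * + 1 ≡ P + (x - + 0)
          ascending = solve-∀
  ... | false | ofⁿ a≮b rewrite interval-empty (ℕ.≮⇒≥ a≮b) (toℕ m) =
    descending (interval (toℕ b) (toℕ a) (toℕ m)) (+ p)
    where descending : ∀ x P → P * + 1 - x ≡ P + (+ 0 - x)
          descending = solve-∀

  βroot-∂ : ∀ a b p r → βroot n a b p r - βroot n a b p (pre r) ≡ δ a r - δ b r
  βroot-∂ a b p r rewrite βroot-segment a b p r | βroot-segment a b p (pre r) =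
    trans (cancel (+ p) (segment (toℕ a) (toℕ b) (toℕ r)) (segment (toℕ a) (toℕ b) (toℕ (pre r))))
          (segment-∂ a b r)
    where cancel : ∀ P x y → P + x - (P + y) ≡ x - y
          cancel = solve-∀

  -- How a word in distinct generators moves a point

  data Dir : Set where
    ↑ ↓ : Dir

  opposite : Dir → Dir
  opposite ↑ = ↓
  opposite ↓ = ↑

  same-or-opposite : ∀ d d′ → d′ ≡ d ⊎ d′ ≡ opposite d
  same-or-opposite ↑ ↑ = inj₁ refl
  same-or-opposite ↑ ↓ = inj₂ refl
  same-or-opposite ↓ ↑ = inj₂ refl
  same-or-opposite ↓ ↓ = inj₁ refl

  Moves : Fin n → Dir → ℤ → Set
  Moves t ↑ z = z %ℕ n ≡ toℕ t
  Moves t ↓ z = z %ℕ n ≡ sucMod (toℕ t)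

  shift : Dir → ℤ → ℤ
  shift ↑ z = z + + 1
  shift ↓ z = z - + 1

  Beyond : Dir → ℤ → ℤ → Set
  Beyond ↑ y z = y ℤ.< z
  Beyond ↓ y z = z ℤ.< y

  data Step (t : Fin n) (z : ℤ) : ℤ → Set where
    moves : ∀ d → Moves t d z → Step t z (shift d z)
    stays : (∀ d → ¬ Moves t d z) → Step t z z

  step : ∀ t z → Step t z (s n t z)
  step t z with z %ℕ n ≡ᵇ toℕ t | ≡ᵇ-reflects (z %ℕ n) (toℕ t)
  ... | true  | ofʸ up = moves ↑ up
  ... | false | ofⁿ ¬up with z %ℕ n ≡ᵇ sucMod (toℕ t) | ≡ᵇ-reflects (z %ℕ n) (sucMod (toℕ t))
  ...   | true  | ofʸ down  = moves ↓ down
  ...   | false | ofⁿ ¬down = stays λ { ↑ → ¬up ; ↓ → ¬down }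

  moves-back : ∀ {t d z} → Moves t d z → Moves t (opposite d) (shift d z)
  moves-back {t} {↑} {z} up   = trans (%ℕ-suc z) (cong sucMod up)
  moves-back {t} {↓} {z} down = sucMod-injective (n%ℕd<d (z - + 1) n) (Fin.toℕ<n t)
    (trans (sym (%ℕ-suc (z - + 1))) (trans (cong (_%ℕ n) (z-1+1 z)) down))
    where z-1+1 : ∀ z → z - + 1 + + 1 ≡ z
          z-1+1 = solve-∀

  moves-injective : ∀ {t t′ d z} → Moves t d z → Moves t′ d z → t ≡ t′
  moves-injective {d = ↑} up up′ = Fin.toℕ-injective (trans (sym up) up′)
  moves-injective {t} {t′} {↓} down down′ =
    Fin.toℕ-injective (sucMod-injective (Fin.toℕ<n t) (Fin.toℕ<n t′) (trans (sym down) down′))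

  shift-beyond : ∀ d z → Beyond d z (shift d z)
  shift-beyond ↑ z = subst (ℤ._< z + + 1) (ℤ.+-identityʳ z) (ℤ.+-monoʳ-< z (ℤ.+<+ (s≤s z≤n)))
  shift-beyond ↓ z = subst (z - + 1 ℤ.<_) (ℤ.+-identityʳ z) (ℤ.+-monoʳ-< z ℤ.-<+)

  beyond-shift : ∀ {d y z} → Beyond d y z → Beyond d y (shift d z)
  beyond-shift {↑} {y} {z} y<z = ℤ.<-trans y<z (shift-beyond ↑ z)
  beyond-shift {↓} {y} {z} z<y = ℤ.<-trans (shift-beyond ↓ z) z<y

  word : ∀ K → (Fin K → Fin n) → ℤ → ℤ
  word K k = foldr (λ t f → s n t ∘ f) id (tabulate k)

  -- After s_t has moved z in direction d, only s_t itself could move z back; as the generators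
  -- of the word are distinct, once z has moved it keeps moving the same way.
  Moved : ∀ {K} → (Fin K → Fin n) → Dir → ℤ → ℤ → Set
  Moved k d y z = Beyond d y z × ∃[ a ] Moves (k a) (opposite d) z

  moved-step : ∀ {K} {k : Fin (suc K) → Fin n} {d y z} → Injective _≡_ _≡_ k →
               Moved (k ∘ Fin.suc) d y z → Moved k d y (s n (k Fin.zero) z)
  moved-step {k = k} {d} {y} {z} k-inj (beyond , a , back)
    with s n (k Fin.zero) z | step (k Fin.zero) z
  ... | _ | stays _ = beyond , Fin.suc a , back
  ... | _ | moves d′ m with same-or-opposite d d′
  ...   | inj₁ refl = beyond-shift beyond , Fin.zero , moves-back m
  ...   | inj₂ refl = contradiction (k-inj (moves-injective m back)) λ ()

  stays-or-moves : ∀ {K} {k : Fin K → Fin n} {d y} → Injective _≡_ _≡_ k →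
                   (∀ a → ¬ Moves (k a) (opposite d) y) → word K k y ≡ y ⊎ Moved k d y (word K k y)
  stays-or-moves {zero}  _ _ = inj₁ refl
  stays-or-moves {suc K} {k} {d} {y} k-inj unopposed
    with stays-or-moves (Fin.suc-injective ∘ k-inj) (unopposed ∘ Fin.suc)
  ... | inj₂ moved = inj₂ (moved-step k-inj moved)
  ... | inj₁ fixed rewrite fixed with s n (k Fin.zero) y | step (k Fin.zero) y
  ...   | _ | stays _ = inj₁ refl
  ...   | _ | moves d′ m with same-or-opposite d d′
  ...     | inj₁ refl = inj₂ (shift-beyond d y , Fin.zero , moves-back m)
  ...     | inj₂ refl = contradiction m (unopposed Fin.zero)

  -- The word is applied from its last letter to its first, so the generator at position b acts
  -- on y before any generator that would move y the other way.
  moves-past : ∀ {K} {k : Fin K → Fin n} {d y} → Injective _≡_ _≡_ k → ∀ b → Moves (k b) d y →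
               (∀ a → Moves (k a) (opposite d) y → a Fin.< b) → Moved k d y (word K k y)
  moves-past {suc K} {k} {d} {y} k-inj Fin.zero first later
    with stays-or-moves (Fin.suc-injective ∘ k-inj) (λ a m → ℕ.n≮0 (later (Fin.suc a) m))
  ... | inj₂ moved = moved-step k-inj moved
  ... | inj₁ fixed rewrite fixed with s n (k Fin.zero) y | step (k Fin.zero) y
  ...   | _ | stays still = contradiction first (still d)
  ...   | _ | moves d′ m with same-or-opposite d d′
  ...     | inj₁ refl = shift-beyond d y , Fin.zero , moves-back m
  ...     | inj₂ refl = contradiction (later Fin.zero m) ℕ.n≮0
  moves-past {suc K} k-inj (Fin.suc b) first later = moved-step k-inj
    (moves-past (Fin.suc-injective ∘ k-inj) b first (λ a m → ℕ.s<s⁻¹ (later (Fin.suc a) m)))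

  coxFun≡word : ∀ w → coxFun n w ≡ word n (w ⟨$⟩ʳ_)
  coxFun≡word w = fold-tabulate id
    where
    fold-tabulate : ∀ {K} (e : Fin K → Fin n) →
                    foldr (λ t f → s n (w ⟨$⟩ʳ t) ∘ f) id (tabulate e) ≡ word K ((w ⟨$⟩ʳ_) ∘ e)
    fold-tabulate {zero}  e = refl
    fold-tabulate {suc K} e = cong (s n (w ⟨$⟩ʳ e Fin.zero) ∘_) (fold-tabulate (e ∘ Fin.suc))

  module _ (w : Permutation′ n) (r : Fin n) where
    private
      pos gen : Fin n → Fin n
      pos = w ⟨$⟩ˡ_
      gen = w ⟨$⟩ʳ_

      y : ℤ
      y = + toℕ r

      y%n : y %ℕ n ≡ toℕ r
      y%n = m<n⇒m%n≡m (Fin.toℕ<n r)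

      gen-injective : Injective _≡_ _≡_ gen
      gen-injective = Injection.injective (↔⇒↣ w)

      pos-injective : Injective _≡_ _≡_ pos
      pos-injective = Injection.injective (↔⇒↣ (flip w))

      position-of : ∀ {a t} → gen a ≡ t → a ≡ pos t
      position-of refl = sym (inverseˡ w)

      moves-up⇒r : ∀ {t} → Moves t ↑ y → t ≡ r
      moves-up⇒r up = Fin.toℕ-injective (trans (sym up) y%n)

      moves-down⇒pre : ∀ {t} → Moves t ↓ y → t ≡ pre r
      moves-down⇒pre down = sucMod≡⇒pre (trans (sym down) y%n)

      r-moves-up : Moves (gen (pos r)) ↑ y
      r-moves-up = subst (λ t → Moves t ↑ y) (sym (inverseʳ w)) y%n

      pre-moves-down : Moves (gen (pos (pre r))) ↓ y
      pre-moves-down =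
        subst (λ t → Moves t ↓ y) (sym (inverseʳ w)) (trans y%n (sym (sucMod-pre r)))

      cox≡word : coxFun n w y ≡ word n gen y
      cox≡word = cong (_$ y) (coxFun≡word w)

    cox-descends : toℕ (pos r) ℕ.< toℕ (pos (pre r)) → coxFun n w y ℤ.< y
    cox-descends r<pr = subst (ℤ._< y) (sym cox≡word) (proj₁
      (moves-past {d = ↓} gen-injective (pos (pre r)) pre-moves-down λ a m →
        subst (λ b → toℕ b ℕ.< toℕ (pos (pre r))) (sym (position-of (moves-up⇒r m))) r<pr))

    cox-ascends : toℕ (pos (pre r)) ℕ.< toℕ (pos r) → y ℤ.< coxFun n w y
    cox-ascends pr<r = subst (y ℤ.<_) (sym cox≡word) (proj₁
      (moves-past {d = ↑} gen-injective (pos r) r-moves-up λ a m →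
        subst (λ b → toℕ b ℕ.< toℕ (pos r)) (sym (position-of (moves-down⇒pre m))) pr<r))

    inR≡before : 1 ≤ N → inR n w y ≡ before n w r (pre r)
    inR≡before 1≤N with ℕ.<-cmp (toℕ (pos r)) (toℕ (pos (pre r)))
    ... | tri< r<pr _ _ = trans (dec-true (coxFun n w y <? y) (cox-descends r<pr))
                                (sym (det (ℕ.<ᵇ-reflects-< _ _) (ofʸ r<pr)))
    ... | tri≈ _ r≡pr _ = contradiction (sym (pos-injective (Fin.toℕ-injective r≡pr)))
                                        (pre-irreflexive 1≤N r)
    ... | tri> _ _ pr<r = trans (dec-false (coxFun n w y <? y) (ℤ.<-asym (cox-ascends pr<r)))
                                (sym (det (ℕ.<ᵇ-reflects-< _ _) (ofⁿ (ℕ.<-asym pr<r))))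

  -- The form ω_c as a sum over the edges of the cycle

  ∑∑-adjacent : 2 ≤ N → (F : Fin n → Fin n → ℤ) →
                (∀ a b → a ≢ pre b → b ≢ pre a → F a b ≡ + 0) →
                sum (λ a → sum (F a)) ≡ sum (λ r → F (pre r) r + F r (pre r))
  ∑∑-adjacent 2≤N F apart = begin
    sum (λ a → sum (F a))
      ≡⟨ sum-cong-≗ (λ a → trans (sum-cong-≗ (split a)) (∑-distrib-+ (F₁ a) (F₂ a))) ⟩
    sum (λ a → sum (F₁ a) + sum (F₂ a))
      ≡⟨ ∑-distrib-+ (λ a → sum (F₁ a)) (λ a → sum (F₂ a)) ⟩
    sum (λ a → sum (F₁ a)) + sum (λ a → sum (F₂ a))
      ≡⟨ cong₂ _+_ (trans (∑-comm F₁) (sum-cong-≗ F₁-column)) (sum-cong-≗ F₂-row) ⟩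
    sum (λ r → F (pre r) r) + sum (λ r → F r (pre r))
      ≡⟨ ∑-distrib-+ (λ r → F (pre r) r) (λ r → F r (pre r)) ⟨
    sum (λ r → F (pre r) r + F r (pre r))
      ∎
    where
    open ≡-Reasoning
    F₁ F₂ : Fin n → Fin n → ℤ
    F₁ a b = if does (a Fin.≟ pre b) then F a b else + 0
    F₂ a b = if does (a Fin.≟ pre b) then + 0 else F a b

    split : ∀ a b → F a b ≡ F₁ a b + F₂ a b
    split a b with a Fin.≟ pre b
    ... | yes _ = sym (ℤ.+-identityʳ (F a b))
    ... | no  _ = sym (ℤ.+-identityˡ (F a b))

    F₁-column : ∀ b → sum (λ a → F₁ a b) ≡ F (pre b) b
    F₁-column b = trans (sum-supported _ (pre b) off) on
      where
      off : ∀ a → a ≢ pre b → F₁ a b ≡ + 0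
      off a a≢pb with a Fin.≟ pre b
      ... | yes a≡pb = contradiction a≡pb a≢pb
      ... | no  _    = refl
      on : F₁ (pre b) b ≡ F (pre b) b
      on with pre b Fin.≟ pre b
      ... | yes _  = refl
      ... | no  ne = contradiction refl ne

    F₂-row : ∀ a → sum (F₂ a) ≡ F a (pre a)
    F₂-row a = trans (sum-supported _ (pre a) off) on
      where
      off : ∀ b → b ≢ pre a → F₂ a b ≡ + 0
      off b b≢pa with a Fin.≟ pre b
      ... | yes _    = refl
      ... | no  a≢pb = apart a b a≢pb b≢pa
      on : F₂ a (pre a) ≡ F a (pre a)
      on with a Fin.≟ pre (pre a)
      ... | yes a≡ppa = contradiction (sym a≡ppa) (pre²-irreflexive 2≤N a)
      ... | no  _     = refl

  module _ (w : Permutation′ n) where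

    Y : ℕ → ℤ
    Y x = sgn (inR n w (+ x))

    before-flip : ∀ {a b} → a ≢ b → before n w b a ≡ not (before n w a b)
    before-flip {a} {b} a≢b with ℕ.<-cmp (toℕ (w ⟨$⟩ˡ a)) (toℕ (w ⟨$⟩ˡ b))
    ... | tri< a<b _ _ rewrite det (ℕ.<ᵇ-reflects-< _ _) (ofʸ a<b)
                             | det (ℕ.<ᵇ-reflects-< _ _) (ofⁿ (ℕ.<-asym a<b)) = refl
    ... | tri≈ _ a≡b _ =
      contradiction (Injection.injective (↔⇒↣ (flip w)) (Fin.toℕ-injective a≡b)) a≢b
    ... | tri> _ _ b<a rewrite det (ℕ.<ᵇ-reflects-< _ _) (ofʸ b<a)
                             | det (ℕ.<ᵇ-reflects-< _ _) (ofⁿ (ℕ.<-asym b<a)) = refl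

    ωbasis-apart : ∀ {a b} → a ≢ pre b → b ≢ pre a → ωbasis n w a b ≡ + 0
    ωbasis-apart {a} {b} a≢pb b≢pa
      rewrite det (≡ᵇ-reflects (sucMod (toℕ a)) (toℕ b)) (ofⁿ (a≢pb ∘ sucMod≡⇒pre))
            | det (≡ᵇ-reflects (sucMod (toℕ b)) (toℕ a)) (ofⁿ (b≢pa ∘ sucMod≡⇒pre)) = refl

    ωbasis-pre-r≡Y : 1 ≤ N → ∀ r → ωbasis n w (pre r) r ≡ Y (toℕ r)
    ωbasis-pre-r≡Y 1≤N r
      rewrite det (≡ᵇ-reflects (sucMod (toℕ (pre r))) (toℕ r)) (ofʸ (sucMod-pre r))
            | before-flip (pre-irreflexive 1≤N r ∘ sym) | inR≡before w r 1≤N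
      with before n w r (pre r)
    ... | true  = refl
    ... | false = refl

    ωbasis-r-pre≡-Y : 2 ≤ N → ∀ r → ωbasis n w r (pre r) ≡ - Y (toℕ r)
    ωbasis-r-pre≡-Y 2≤N r
      rewrite det (≡ᵇ-reflects (sucMod (toℕ r)) (toℕ (pre r)))
                  (ofⁿ (pre²-irreflexive 2≤N r ∘ sym ∘ sucMod≡⇒pre))
            | det (≡ᵇ-reflects (sucMod (toℕ (pre r))) (toℕ r)) (ofʸ (sucMod-pre r))
            | inR≡before w r (ℕ.<⇒≤ 2≤N)
      with before n w r (pre r)
    ... | true  = refl
    ... | false = refl

    ω≡edge-sum : 2 ≤ N → ∀ u v →
                 ω n w u v ≡ sum (λ r → Y (toℕ r) * (u (pre r) * v r - u r * v (pre r)))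
    ω≡edge-sum 2≤N u v = begin
      ω n w u v
        ≡⟨ trans (Σ≡sum n (λ a → Σ[ n ] (F a))) (sum-cong-≗ (λ a → Σ≡sum n (F a))) ⟩
      sum (λ a → sum (F a))
        ≡⟨ ∑∑-adjacent 2≤N F (λ a b a≢pb b≢pa →
             trans (cong (u a * v b *_) (ωbasis-apart a≢pb b≢pa)) (ℤ.*-zeroʳ (u a * v b))) ⟩
      sum (λ r → u (pre r) * v r * ωbasis n w (pre r) r + u r * v (pre r) * ωbasis n w r (pre r))
        ≡⟨ sum-cong-≗ (λ r → trans (cong₂ (λ x y → u (pre r) * v r * x + u r * v (pre r) * y)
                                            (ωbasis-pre-r≡Y (ℕ.<⇒≤ 2≤N) r) (ωbasis-r-pre≡-Y 2≤N r))
                                   (collect (Y (toℕ r)) (u (pre r)) (v r) (u r) (v (pre r)))) ⟩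
      sum (λ r → Y (toℕ r) * (u (pre r) * v r - u r * v (pre r)))
        ∎
      where
      open ≡-Reasoning
      F : Fin n → Fin n → ℤ
      F a b = u a * v b * ωbasis n w a b
      collect : ∀ y a b c d → a * b * y + c * d * - y ≡ y * (a * b - c * d)
      collect = solve-∀

    ω-βroots : 2 ≤ N → ∀ i j k p q →
      let i′ = toℕ i ; j′ = toℕ j ; k′ = toℕ k in
      ω n w (βroot n i j p) (βroot n j k q)
        ≡ Y j′ * (+ p + segment i′ j′ j′) - Y k′ * (+ p + segment i′ j′ k′)
          - (Y i′ * (+ q + segment j′ k′ i′) - Y j′ * (+ q + segment j′ k′ j′))
    ω-βroots 2≤N i j k p q = begin
      ω n w u v
        ≡⟨ ω≡edge-sum 2≤N u v ⟩
      sum (λ r → Y (toℕ r) * (u (pre r) * v r - u r * v (pre r)))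
        ≡⟨ ∑-by-parts (Y ∘ toℕ) u v (βroot-∂ i j p) (βroot-∂ j k q) ⟩
      Y (toℕ j) * u j - Y (toℕ k) * u k - (Y (toℕ i) * v i - Y (toℕ j) * v j)
        ≡⟨ cong₂ _-_ (cong₂ _-_ (at j (βroot-segment i j p j)) (at k (βroot-segment i j p k)))
                     (cong₂ _-_ (at i (βroot-segment j k q i)) (at j (βroot-segment j k q j))) ⟩
      _ ∎
      where
      open ≡-Reasoning
      u = βroot n i j p
      v = βroot n j k q
      at : ∀ a {x x′} → x ≡ x′ → Y (toℕ a) * x ≡ Y (toℕ a) * x′
      at a = cong (Y (toℕ a) *_)

sgn-difference : ∀ a b → sgn a - sgn b ≡ - + 2 * (ind a - ind b)
sgn-difference false false = refl
sgn-difference false true  = refl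
sgn-difference true  false = refl
sgn-difference true  true  = refl

-- The conditions p ≥ δ_{i>j} and q ≥ δ_{j>k} only make the roots positive; the identity holds
-- for all p and q.
proposition2p8 : (n : ℕ) {{nz : NonZero n}} → 3 ≤ n →
    (w : Permutation′ n) →
    (i j k : Fin n) → i ≢ j → j ≢ k → i ≢ k →
    (p q : ℕ) → (toℕ j < toℕ i → 1 ≤ p) → (toℕ k < toℕ j → 1 ≤ q) →
    ω n w (βroot n i j p) (βroot n j k q)
      ≡ signσ (toℕ i) (toℕ j) (toℕ k)
          * sgn (inR n w (+ σ (toℕ i) (toℕ j) (toℕ k) (toℕ j)))
        - + 2 * + p * (ind (inR n w (+ toℕ j)) - ind (inR n w (+ toℕ k)))
        + + 2 * + q * (ind (inR n w (+ toℕ i)) - ind (inR n w (+ toℕ j)))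
proposition2p8 (suc N) (s≤s 2≤N) w i j k i≢j j≢k i≢k p q _ _ = begin
  ω n w (βroot n i j p) (βroot n j k q)
    ≡⟨ ω-βroots w 2≤N i j k p q ⟩
  y j′ * (P + Sᵢⱼ j′) - y k′ * (P + Sᵢⱼ k′) - (y i′ * (Q + Sⱼₖ i′) - y j′ * (Q + Sⱼₖ j′))
    ≡⟨ separate P Q (y i′) (y j′) (y k′) (Sᵢⱼ j′) (Sᵢⱼ k′) (Sⱼₖ i′) (Sⱼₖ j′) ⟩
  (y j′ * Sᵢⱼ j′ - y k′ * Sᵢⱼ k′ - (y i′ * Sⱼₖ i′ - y j′ * Sⱼₖ j′))
    + P * (y j′ - y k′) + Q * (y j′ - y i′)
    ≡⟨ cong₂ _+_ (cong₂ (λ a b → a + P * b) (median-identity y i′≢j′ j′≢k′ i′≢k′)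
                                           (sgn-difference bj bk))
                 (cong (Q *_) (sgn-difference bj bi)) ⟩
  signσ i′ j′ k′ * y (σ i′ j′ k′ j′) + P * (- + 2 * (ind bj - ind bk)) + Q * (- + 2 * (ind bj - ind bi))
    ≡⟨ finish (signσ i′ j′ k′ * y (σ i′ j′ k′ j′)) P Q (ind bi) (ind bj) (ind bk) ⟩
  signσ i′ j′ k′ * y (σ i′ j′ k′ j′) - + 2 * P * (ind bj - ind bk) + + 2 * Q * (ind bi - ind bj)
    ∎
  where
  open Cycle N
  open ≡-Reasoning
  i′ = toℕ i
  j′ = toℕ j
  k′ = toℕ k
  i′≢j′ = i≢j ∘ Fin.toℕ-injective
  j′≢k′ = j≢k ∘ Fin.toℕ-injective
  i′≢k′ = i≢k ∘ Fin.toℕ-injective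
  y = Y w
  bi = inR n w (+ i′)
  bj = inR n w (+ j′)
  bk = inR n w (+ k′)
  P = + p
  Q = + q
  Sᵢⱼ = segment i′ j′
  Sⱼₖ = segment j′ k′
  separate : ∀ P Q yi yj yk A B C D →
    yj * (P + A) - yk * (P + B) - (yi * (Q + C) - yj * (Q + D))
      ≡ (yj * A - yk * B - (yi * C - yj * D)) + P * (yj - yk) + Q * (yj - yi)
  separate = solve-∀
  finish : ∀ E P Q a b c →
    E + P * (- + 2 * (b - c)) + Q * (- + 2 * (b - a)) ≡ E - + 2 * P * (b - c) + + 2 * Q * (a - b)
  finish = solve-∀
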